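{- Let $r$ be a nonnegative integer. If $\pi$ is a $(2r+4)\times(2r+4)$-grid permutation, then $w(\pi)\ge r$.
   Context: A permutation is a pair $\pi=(S,P)$, $S$ a finite set of positive integers, $P:S\to\mathbb{N}^2$ injective with $P(S)$ in general position. Intervals are discrete $[a,b]=\{a,\dots,b\}$, and $[a,b]<[a',b']$ means $b<a'$. A point set $M$ contains an $r\times s$-grid if there are intervals $I_1<\dots<I_r$ partitioning an interval and $J_1<\dots<J_s$ partitioning an interval such that each cell $I_x\times J_y$ meets $M$; $\pi$ contains an $r\times s$-grid if $P(S)$ does. An $r\times s$-grid permutation is a permutation of length $rs$ that contains an $r\times s$-grid. A rectangle is $R=I_1(R)\times I_2(R)$ with intervals $I_1(R),I_2(R)$. A rectangle family is $\mathcal{R}=(S,R)$ assigning a rectangle to each index of a finite $S\subseteq\mathbb{N}$; a permutation is the family $R(i)=\{P(i)\}$. $\mathcal{R}[i,j\to k]$ ($k\notin S$) replaces $R(i),R(j)$ by their bounding box indexed $k$. A decomposition of $\pi$ is $(\mathcal{R}_0,\dots,\mathcal{R}_s)$ with $\mathcal{R}_0=\pi$, $\max S<k_1<\dots<k_s$, $\mathcal{R}_p=\mathcal{R}_{p-1}[i,j\to k_p]$, $|\mathcal{R}_s|=1$. $R,R'$ $\alpha$-view each other if $I_\alpha(R)\cap I_\alpha(R')\ne\emptyset$; $\mathrm{view}(\mathcal{R},i)=\max_{\alpha\in\{1,2\}}|\{j\ne i:R(i),R(j)\ \alpha\text{ -view each other}\}|$; $\mathcal{R}$ is $d$-wide if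 $\mathrm{view}(\mathcal{R},i)<d$ for all $i$; a decomposition is $d$-wide if all its families are; $w(\pi)$ is the minimum $d$ such that $\pi$ has a $d$-wide decomposition. -}

module Defs where

open import Data.Nat using (ℕ; zero; suc; _+_; _*_; _≤_; _<_; _≤?_; _⊔_)
open import Data.Nat.Properties using (m≤m⊔n; m≤n⊔m; ⊔-lub; ≤-trans)
open import Data.Product using (Σ; ∃; _×_; _,_; proj₁; proj₂)
open import Data.List using (List; []; _∷_; length; map; filter; foldr)
open import Data.List.Membership.Propositional using (_∈_; _∉_)
open import Data.List.Relation.Unary.All using (All)
open import Data.List.Relation.Unary.Unique.Propositional using (Unique)
open import Data.List.Relation.Binary.Permutation.Propositional using (_↭_)
open import Relation.Binary.PropositionalEquality using (_≡_; _≢_)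
open import Relation.Nullary using (Dec; yes; no; ¬_)
open import Relation.Nullary.Decidable using (_×-dec_; ¬?)
open import Data.Nat using (_≟_)

Point : Set
Point = ℕ × ℕ

record Interval : Set where
  constructor [_,_]
  field
    lo : ℕ
    hi : ℕ
open Interval public

_∈I_ : ℕ → Interval → Set
x ∈I I = lo I ≤ x × x ≤ hi I

Meets : Interval → Interval → Set
Meets I J = Σ ℕ λ x → x ∈I I × x ∈I J

meets? : (I J : Interval) → Dec (Meets I J)
meets? I J with lo I ≤? hi J | lo J ≤? hi I | lo I ≤? hi I | lo J ≤? hi J
... | yes a | yes b | yes c | yes d =
  yes (lo I ⊔ lo J , (m≤m⊔n (lo I) (lo J) , ⊔-lub c b) , (m≤n⊔m (lo I) (lo J) , ⊔-lub a d))
... | no ¬a | _ | _ | _ = no λ { (x , (p , q) , (r , s)) → ¬a (≤-trans p s) }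
... | _ | no ¬b | _ | _ = no λ { (x , (p , q) , (r , s)) → ¬b (≤-trans r q) }
... | _ | _ | no ¬c | _ = no λ { (x , (p , q) , (r , s)) → ¬c (≤-trans p q) }
... | _ | _ | _ | no ¬d = no λ { (x , (p , q) , (r , s)) → ¬d (≤-trans r s) }

record Perm : Set where
  field
    S       : List ℕ
    P       : ℕ → Point
    uniqS   : Unique S
    posS    : All (λ i → 0 < i) S
    injP    : ∀ {i j} → i ∈ S → j ∈ S → P i ≡ P j → i ≡ j
    genPos  : ∀ {i j} → i ∈ S → j ∈ S → i ≢ j →
              (proj₁ (P i) ≢ proj₁ (P j)) × (proj₂ (P i) ≢ proj₂ (P j))
open Perm public

maxS : Perm → ℕ
maxS π = foldr _⊔_ 0 (S π)

pointSet : Perm → List Point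
pointSet π = map (P π) (S π)

ConsecutiveChain : ℕ → (ℕ → Interval) → Set
ConsecutiveChain r I = ∀ x → suc x < r → lo (I (suc x)) ≡ suc (hi (I x))

ContainsGrid : ℕ → ℕ → List Point → Set
ContainsGrid r s M =
  Σ (ℕ → Interval) λ I → Σ (ℕ → Interval) λ J →
    ConsecutiveChain r I × ConsecutiveChain s J ×
    (∀ x y → x < r → y < s →
       Σ Point λ p → p ∈ M × proj₁ p ∈I I x × proj₂ p ∈I J y)

PermContainsGrid : ℕ → ℕ → Perm → Set
PermContainsGrid r s π = ContainsGrid r s (pointSet π)

GridPerm : ℕ → ℕ → Perm → Set
GridPerm r s π = length (S π) ≡ r * s × PermContainsGrid r s π

Rect : Set
Rect = Interval × Interval

data Axis : Set where
  ax1 ax2 : Axis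

Iα : Axis → Rect → Interval
Iα ax1 R = proj₁ R
Iα ax2 R = proj₂ R

pointRect : Point → Rect
pointRect (x , y) = ([ x , x ] , [ y , y ])

bboxI : Interval → Interval → Interval
bboxI I J = [ lo I Data.Nat.⊓ lo J , hi I ⊔ hi J ]

bbox : Rect → Rect → Rect
bbox (I₁ , I₂) (J₁ , J₂) = (bboxI I₁ J₁ , bboxI I₂ J₂)

-- a rectangle family: list of (index , rectangle) pairs (indices distinct)
Family : Set
Family = List (ℕ × Rect)

dom : Family → List ℕ
dom = map proj₁

permFamily : Perm → Family
permFamily π = map (λ i → (i , pointRect (P π i))) (S π)

viewα : Axis → Family → ℕ → Rect → ℕ
viewα α F i R =
  length (filter (λ e → ¬? (proj₁ e ≟ i) ×-dec meets? (Iα α R) (Iα α (proj₂ e))) F)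

view : Family → ℕ → Rect → ℕ
view F i R = viewα ax1 F i R ⊔ viewα ax2 F i R

Wide : ℕ → Family → Set
Wide d F = All (λ e → view F (proj₁ e) (proj₂ e) < d) F

-- Decomp m F: a decomposition sequence starting at F in
-- which every new index is larger than m and than all previous new indices.

data Decomp : ℕ → Family → Set where
  finish : ∀ {m F} → length F ≡ 1 → Decomp m F
  merge  : ∀ {m F} (i j k : ℕ) (A B : Rect) (G : Family) →
           F ↭ ((i , A) ∷ (j , B) ∷ G) → i ≢ j → k ∉ dom F → m < k →
           Decomp k ((k , bbox A B) ∷ G) → Decomp m F

families : ∀ {m F} → Decomp m F → List Family
families {F = F} (finish _) = F ∷ []
families {F = F} (merge _ _ _ _ _ _ _ _ _ _ D) = F ∷ families D

Decomposition : Perm → Set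
Decomposition π = Decomp (maxS π) (permFamily π)

WideDecomp : ℕ → ∀ {m F} → Decomp m F → Set
WideDecomp d D = All (Wide d) (families D)

module Submission where

-- Let the grid have n × n cells with n ≥ 2r + 3 (the theorem is
-- the case n = 2r + 4), and fix one point of π in every cell.  Call a
-- rectangle α-spanning if its α-extent meets two grid lines a and b of axis α
-- with a + 1 < b, so that it contains the whole line a + 1; call it narrow if
-- it is spanning in neither axis.  Along a decomposition we keep two
-- invariants: every chosen cell point lies in some rectangle of the family,
-- and all rectangles are narrow.  Both hold for π itself (points are narrow).
-- They cannot hold at the end: the single remaining rectangle contains the
-- points of cells (0,0) and (2,0), so it is spanning.  Hence some merge
-- creates an α-spanning rectangle R containing line c = a + 1.  The r + 2
-- chosen points of line c at positions 0, 2, …, 2r + 2 lie in distinct narrow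
-- rectangles of the previous family, each of which α-views R; at most two of
-- them were merged into R, so R α-views at least r others, and a d-wide
-- decomposition forces r < d.  We argue from the assumption d ≤ r: then no
-- merge can create a spanning rectangle, so the invariants survive to the end.

open import Defs
open import Data.Nat using (ℕ; _+_; _*_; _≤_; suc; _<_; _≤?_; _≟_; z≤n; s≤s; z<s; s≤s⁻¹)
open import Data.Nat.Properties
open import Data.Fin using (Fin; toℕ)
open import Data.Fin.Properties using (injective⇒≤; toℕ-injective; toℕ<n)
open import Data.Product using (Σ; _×_; _,_; proj₁; proj₂)
open import Data.Sum using (inj₁; inj₂)
open import Data.Empty using (⊥; ⊥-elim)
open import Data.List using (List; []; _∷_; length; filter; lookup)
open import Data.List.Membership.Propositional using (_∈_; _∉_)
open import Data.List.Membership.Propositional.Properties using (∈-filter⁺; ∈-map⁺; ∈-map⁻)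
open import Data.List.Relation.Unary.Any using (here; there; index)
open import Data.List.Relation.Unary.Any.Properties using (lookup-index)
open import Data.List.Relation.Unary.All using (_∷_; head)
open import Data.List.Relation.Binary.Permutation.Propositional using (_↭_; ↭-sym)
open import Data.List.Relation.Binary.Permutation.Propositional.Properties using (∈-resp-↭)
open import Function.Definitions using (Injective)
open import Relation.Binary using (tri<; tri≈; tri>)
open import Relation.Binary.PropositionalEquality using (_≡_; _≢_; refl; sym; cong; subst; module ≡-Reasoning)
open import Relation.Nullary using (Dec; yes; no; ¬_)
open import Relation.Nullary.Decidable using (_×-dec_; ¬?)

distinct-members⇒≤ : ∀ {X : Set} {K} (L : List X) (f : Fin K → X) →
                     (∀ m → f m ∈ L) → Injective _≡_ _≡_ f → K ≤ length L
distinct-members⇒≤ L f f∈L f-inj = injective⇒≤ position-injective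
  where
  position-injective : Injective _≡_ _≡_ (λ m → index (f∈L m))
  position-injective {m} {m'} same-position = f-inj (begin
    f m                        ≡⟨ lookup-index (f∈L m) ⟩
    lookup L (index (f∈L m))   ≡⟨ cong (lookup L) same-position ⟩
    lookup L (index (f∈L m'))  ≡⟨ sym (lookup-index (f∈L m')) ⟩
    f m'                       ∎)
    where open ≡-Reasoning

other : Axis → Axis
other ax1 = ax2
other ax2 = ax1

coord : Axis → Point → ℕ
coord ax1 = proj₁
coord ax2 = proj₂

_∈R_ : Point → Rect → Set
p ∈R R = ∀ α → coord α p ∈I Iα α R

∈R-pointRect : ∀ p → p ∈R pointRect p
∈R-pointRect p ax1 = ≤-refl , ≤-refl
∈R-pointRect p ax2 = ≤-refl , ≤-refl

pointRect-degenerate : ∀ α p → lo (Iα α (pointRect p)) ≡ hi (Iα α (pointRect p))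
pointRect-degenerate ax1 p = refl
pointRect-degenerate ax2 p = refl

∈I-bboxˡ : ∀ {z} I J → z ∈I I → z ∈I bboxI I J
∈I-bboxˡ I J (lo≤z , z≤hi) = ≤-trans (m⊓n≤m _ _) lo≤z , ≤-trans z≤hi (m≤m⊔n _ _)

∈I-bboxʳ : ∀ {z} I J → z ∈I J → z ∈I bboxI I J
∈I-bboxʳ I J (lo≤z , z≤hi) = ≤-trans (m⊓n≤n _ _) lo≤z , ≤-trans z≤hi (m≤n⊔m _ _)

∈R-bboxˡ : ∀ {p} A B → p ∈R A → p ∈R bbox A B
∈R-bboxˡ A B p∈A ax1 = ∈I-bboxˡ (proj₁ A) (proj₁ B) (p∈A ax1)
∈R-bboxˡ A B p∈A ax2 = ∈I-bboxˡ (proj₂ A) (proj₂ B) (p∈A ax2)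

∈R-bboxʳ : ∀ {p} A B → p ∈R B → p ∈R bbox A B
∈R-bboxʳ A B p∈B ax1 = ∈I-bboxʳ (proj₁ A) (proj₁ B) (p∈B ax1)
∈R-bboxʳ A B p∈B ax2 = ∈I-bboxʳ (proj₂ A) (proj₂ B) (p∈B ax2)

viewα≤view : ∀ α F i R → viewα α F i R ≤ view F i R
viewα≤view ax1 F i R = m≤m⊔n _ _
viewα≤view ax2 F i R = m≤n⊔m _ _

head-wide : ∀ {d m F} (D : Decomp m F) → WideDecomp d D → Wide d F
head-wide (finish _) wide = head wide
head-wide (merge _ _ _ _ _ _ _ _ _ _ _) wide = head wide

module GridArgument
  (π : Perm) (n : ℕ) (cols rows : ℕ → Interval)
  (cols-chain : ConsecutiveChain n cols) (rows-chain : ConsecutiveChain n rows)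
  (cells : ∀ x y → x < n → y < n →
           Σ Point λ p → p ∈ pointSet π × proj₁ p ∈I cols x × proj₂ p ∈I rows y)
  where

  line : Axis → ℕ → Interval
  line ax1 = cols
  line ax2 = rows

  line-chain : ∀ α → ConsecutiveChain n (line α)
  line-chain ax1 = cols-chain
  line-chain ax2 = rows-chain

  gridPt : (α : Axis) (a b : ℕ) → a < n → b < n → Point
  gridPt ax1 a b a<n b<n = proj₁ (cells a b a<n b<n)
  gridPt ax2 a b a<n b<n = proj₁ (cells b a b<n a<n)

  gridPt-along : ∀ α a b a<n b<n → coord α (gridPt α a b a<n b<n) ∈I line α a
  gridPt-along ax1 a b a<n b<n = proj₁ (proj₂ (proj₂ (cells a b a<n b<n)))
  gridPt-along ax2 a b a<n b<n = proj₂ (proj₂ (proj₂ (cells b a b<n a<n)))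

  gridPt-across : ∀ α a b a<n b<n → coord (other α) (gridPt α a b a<n b<n) ∈I line (other α) b
  gridPt-across ax1 a b a<n b<n = proj₂ (proj₂ (proj₂ (cells a b a<n b<n)))
  gridPt-across ax2 a b a<n b<n = proj₁ (proj₂ (proj₂ (cells b a b<n a<n)))

  -- Every line contains a chosen point, so it is a nonempty interval.
  line-nonempty : ∀ α a → a < n → lo (line α a) ≤ hi (line α a)
  line-nonempty α a a<n = ≤-trans lo≤z z≤hi
    where
    lo≤z = proj₁ (gridPt-along α a a a<n a<n)
    z≤hi = proj₂ (gridPt-along α a a a<n a<n)

  lines-ordered : ∀ α {a b} → a < b → b < n → hi (line α a) < lo (line α b)
  lines-ordered α {a} {suc b} a<1+b 1+b<n with m≤n⇒m<n∨m≡n (s≤s⁻¹ a<1+b)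
  ... | inj₂ refl = ≤-reflexive (sym (line-chain α a 1+b<n))
  ... | inj₁ a<b = begin-strict
    hi (line α a)        <⟨ lines-ordered α a<b b<n ⟩
    lo (line α b)        ≤⟨ line-nonempty α b b<n ⟩
    hi (line α b)        <⟨ n<1+n _ ⟩
    suc (hi (line α b))  ≡⟨ sym (line-chain α b 1+b<n) ⟩
    lo (line α (suc b))  ∎
    where
    open ≤-Reasoning
    b<n = <-trans (n<1+n b) 1+b<n

  meets-two-lines⇒spread : ∀ α {I a b} → a < b → b < n →
                           Meets I (line α a) → Meets I (line α b) → lo I < hi I
  meets-two-lines⇒spread α {I} {a} {b} a<b b<n
    (w₁ , (lo≤w₁ , _) , (_ , w₁≤hiₐ)) (w₂ , (_ , w₂≤hi) , (lo_b≤w₂ , _)) = begin-strict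
    lo I           ≤⟨ lo≤w₁ ⟩
    w₁             ≤⟨ w₁≤hiₐ ⟩
    hi (line α a)  <⟨ lines-ordered α a<b b<n ⟩
    lo (line α b)  ≤⟨ lo_b≤w₂ ⟩
    w₂             ≤⟨ w₂≤hi ⟩
    hi I           ∎
    where open ≤-Reasoning

  meets-two-lines⇒contains-middle : ∀ α {I a b} → suc a < b → b < n →
    Meets I (line α a) → Meets I (line α b) → ∀ {z} → z ∈I line α (suc a) → z ∈I I
  meets-two-lines⇒contains-middle α {I} {a} {b} 1+a<b b<n
    (w₁ , (lo≤w₁ , _) , (_ , w₁≤hiₐ)) (w₂ , (_ , w₂≤hi) , (lo_b≤w₂ , _)) {z} (lo≤z , z≤hi) =
    (begin
      lo I                 ≤⟨ lo≤w₁ ⟩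
      w₁                   ≤⟨ w₁≤hiₐ ⟩
      hi (line α a)        ≤⟨ n≤1+n _ ⟩
      suc (hi (line α a))  ≡⟨ sym (line-chain α a (<-trans 1+a<b b<n)) ⟩
      lo (line α (suc a))  ≤⟨ lo≤z ⟩
      z                    ∎) ,
    (begin
      z                    ≤⟨ z≤hi ⟩
      hi (line α (suc a))  ≤⟨ <⇒≤ (lines-ordered α 1+a<b b<n) ⟩
      lo (line α b)        ≤⟨ lo_b≤w₂ ⟩
      w₂                   ≤⟨ w₂≤hi ⟩
      hi I                 ∎)
    where open ≤-Reasoning

  Spanning : Axis → Rect → Set
  Spanning α R = Σ ℕ λ a → Σ ℕ λ b → suc a < b × b < n ×
                 Meets (Iα α R) (line α a) × Meets (Iα α R) (line α b)

  Narrow : Rect → Set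
  Narrow R = ∀ α → ¬ Spanning α R

  AllNarrow : Family → Set
  AllNarrow F = ∀ {e} → e ∈ F → Narrow (proj₂ e)

  pointRect-narrow : ∀ p → Narrow (pointRect p)
  pointRect-narrow p α (a , b , 1+a<b , b<n , meets-a , meets-b) =
    <-irrefl (pointRect-degenerate α p)
      (meets-two-lines⇒spread α (<-trans (n<1+n a) 1+a<b) b<n meets-a meets-b)

  meets-across : ∀ α {a b a<n b<n} R → gridPt α a b a<n b<n ∈R R →
                 Meets (Iα (other α) R) (line (other α) b)
  meets-across α {a} {b} {a<n} {b<n} R p∈R = _ , p∈R (other α) , gridPt-across α a b a<n b<n

  even-gap : ∀ {m m'} → m < m' → suc (2 * m) < 2 * m'
  even-gap {m} {m'} m<m' = subst (_≤ 2 * m') (*-suc 2 m) (*-monoʳ-≤ 2 m<m')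

  narrow-separates : ∀ α c {m m'} (c<n : c < n) (2m<n : 2 * m < n) (2m'<n : 2 * m' < n) R →
    Narrow R → gridPt α c (2 * m) c<n 2m<n ∈R R → gridPt α c (2 * m') c<n 2m'<n ∈R R → m ≡ m'
  narrow-separates α c {m} {m'} c<n 2m<n 2m'<n R narrow p∈R p'∈R with <-cmp m m'
  ... | tri≈ _ m≡m' _ = m≡m'
  ... | tri< m<m' _ _ = ⊥-elim (narrow (other α)
        (2 * m , 2 * m' , even-gap m<m' , 2m'<n , meets-across α R p∈R , meets-across α R p'∈R))
  ... | tri> _ _ m'<m = ⊥-elim (narrow (other α)
        (2 * m' , 2 * m , even-gap m'<m , 2m<n , meets-across α R p'∈R , meets-across α R p∈R))

  Covers : Family → Set
  Covers F = ∀ x y (x<n : x < n) (y<n : y < n) →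
             Σ (ℕ × Rect) λ e → e ∈ F × gridPt ax1 x y x<n y<n ∈R proj₂ e

  covers-gridPt : ∀ {F} → Covers F → ∀ α a b a<n b<n →
                  Σ (ℕ × Rect) λ e → e ∈ F × gridPt α a b a<n b<n ∈R proj₂ e
  covers-gridPt covers ax1 a b a<n b<n = covers a b a<n b<n
  covers-gridPt covers ax2 a b a<n b<n = covers b a b<n a<n

  points-cover : Covers (permFamily π)
  points-cover x y x<n y<n with ∈-map⁻ (P π) (proj₁ (proj₂ (cells x y x<n y<n)))
  ... | i , i∈S , p≡P[i] = (i , pointRect (P π i)) , ∈-map⁺ _ i∈S ,
        subst (_∈R pointRect (P π i)) (sym p≡P[i]) (∈R-pointRect (P π i))

  points-narrow : AllNarrow (permFamily π)
  points-narrow e∈F with ∈-map⁻ _ e∈F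
  ... | i , _ , refl = pointRect-narrow (P π i)

  covers-merge : ∀ {F i j k A B G} → F ↭ (i , A) ∷ (j , B) ∷ G →
                 Covers F → Covers ((k , bbox A B) ∷ G)
  covers-merge {A = A} {B} F↭ covers x y x<n y<n with covers x y x<n y<n
  ... | e , e∈F , p∈e with ∈-resp-↭ F↭ e∈F
  ... | here refl = _ , here refl , ∈R-bboxˡ A B p∈e
  ... | there (here refl) = _ , here refl , ∈R-bboxʳ A B p∈e
  ... | there (there e∈G) = e , there e∈G , p∈e

  narrow-merge : ∀ {F i j k A B G} → F ↭ (i , A) ∷ (j , B) ∷ G →
                 AllNarrow F → Narrow (bbox A B) → AllNarrow ((k , bbox A B) ∷ G)
  narrow-merge F↭ narrow merged-narrow (here refl) = merged-narrow
  narrow-merge F↭ narrow merged-narrow (there e∈G) =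
    narrow (∈-resp-↭ (↭-sym F↭) (there (there e∈G)))

  -- A single rectangle covering the grid contains the points of cells (0,0)
  -- and (2,0), so it is spanning.
  single-rectangle-spans : ∀ {F} → 2 < n → length F ≡ 1 → Covers F → ¬ AllNarrow F
  single-rectangle-spans {e ∷ []} 2<n _ covers narrow
    with covers 0 0 0<n 0<n | covers 2 0 2<n 0<n
    where 0<n = <-trans z<s (<-trans (s≤s z<s) 2<n)
  ... | .e , here refl , p₀∈e | .e , here refl , p₂∈e =
    narrow (here refl) ax1 (0 , 2 , s≤s (s≤s z≤n) , 2<n ,
      (_ , p₀∈e ax1 , gridPt-along ax1 0 0 _ _) , (_ , p₂∈e ax1 , gridPt-along ax1 2 0 _ _))

  -- The bound, for a grid with room for r + 2 even positions.
  module Bound (r : ℕ) (room : 2 * r + 3 ≤ n) where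

    even-position<n : ∀ {m} → m < suc (suc r) → 2 * m < n
    even-position<n {m} m<2+r = begin-strict
      2 * m        ≤⟨ *-monoʳ-≤ 2 (s≤s⁻¹ m<2+r) ⟩
      2 * suc r    ≡⟨ *-suc 2 r ⟩
      2 + 2 * r    <⟨ n<1+n _ ⟩
      3 + 2 * r    ≡⟨ +-comm 3 (2 * r) ⟩
      2 * r + 3    ≤⟨ room ⟩
      n            ∎
      where open ≤-Reasoning

    2<n : 2 < n
    2<n = ≤-trans (m≤n+m 3 (2 * r)) room

    -- Merging i and j of a covering narrow family F into an α-spanning R:
    -- the r + 2 even-position points of the spanned line lie in distinct
    -- rectangles of F, all meeting R along α; besides (i , A) and (j , B)
    -- they are α-viewers of R in the new family.
    spanning-merge-views : ∀ {F i j k A B G} α → F ↭ (i , A) ∷ (j , B) ∷ G → k ∉ dom F →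
      Covers F → AllNarrow F → Spanning α (bbox A B) →
      r ≤ viewα α ((k , bbox A B) ∷ G) k (bbox A B)
    spanning-merge-views {F} {i} {j} {k} {A} {B} {G} α F↭ k∉F covers narrow
      (a , b , 1+a<b , b<n , meets-a , meets-b) =
      s≤s⁻¹ (s≤s⁻¹ (distinct-members⇒≤ candidates coverer coverer∈candidates coverer-injective))
      where
      R = bbox A B
      c = suc a
      c<n = <-trans 1+a<b b<n

      α-viewer? : (e : ℕ × Rect) → Dec (proj₁ e ≢ k × Meets (Iα α R) (Iα α (proj₂ e)))
      α-viewer? e = ¬? (proj₁ e ≟ k) ×-dec meets? (Iα α R) (Iα α (proj₂ e))

      viewers : Family
      viewers = filter α-viewer? ((k , R) ∷ G)

      candidates : Family
      candidates = (i , A) ∷ (j , B) ∷ viewers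

      target : Fin (suc (suc r)) → Point
      target m = gridPt α c (2 * toℕ m) c<n (even-position<n (toℕ<n m))

      cover : ∀ m → Σ (ℕ × Rect) λ e → e ∈ F × target m ∈R proj₂ e
      cover m = covers-gridPt covers α c (2 * toℕ m) c<n (even-position<n (toℕ<n m))

      coverer : Fin (suc (suc r)) → ℕ × Rect
      coverer m = proj₁ (cover m)

      target∈R : ∀ m → coord α (target m) ∈I Iα α R
      target∈R m = meets-two-lines⇒contains-middle α 1+a<b b<n meets-a meets-b
                     (gridPt-along α c _ c<n _)

      G-coverer-views : ∀ {e} m → e ∈ F → e ∈ G → target m ∈R proj₂ e → e ∈ viewers
      G-coverer-views {e} m e∈F e∈G t∈e = ∈-filter⁺ α-viewer? (there {x = (k , R)} e∈G)
        ((λ e≡k → k∉F (subst (_∈ dom F) e≡k (∈-map⁺ proj₁ e∈F))) ,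
         (_ , target∈R m , t∈e α))

      coverer∈candidates : ∀ m → coverer m ∈ candidates
      coverer∈candidates m with cover m
      ... | e , e∈F , t∈e with ∈-resp-↭ F↭ e∈F
      ... | here e≡i = here e≡i
      ... | there (here e≡j) = there (here e≡j)
      ... | there (there e∈G) = there (there (G-coverer-views m e∈F e∈G t∈e))

      coverer-injective : Injective _≡_ _≡_ coverer
      coverer-injective {m} {m'} same = toℕ-injective
        (narrow-separates α c c<n _ _ (proj₂ (coverer m)) (narrow (proj₁ (proj₂ (cover m))))
          (proj₂ (proj₂ (cover m)))
          (subst (λ e → target m' ∈R proj₂ e) (sym same) (proj₂ (proj₂ (cover m')))))

    -- No d-wide decomposition with d ≤ r starts from a covering narrow family:
    -- a merge creating a spanning rectangle would give it r viewers.
    no-narrow-wide-decomposition : ∀ {d m F} → d ≤ r → (D : Decomp m F) →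
      Covers F → AllNarrow F → WideDecomp d D → ⊥
    no-narrow-wide-decomposition d≤r (finish one) covers narrow _ =
      single-rectangle-spans 2<n one covers narrow
    no-narrow-wide-decomposition {d} d≤r (merge i j k A B G F↭ _ k∉F _ D) covers narrow (_ ∷ wide) =
      no-narrow-wide-decomposition d≤r D (covers-merge F↭ covers)
        (narrow-merge F↭ narrow merged-narrow) wide
      where
      merged-narrow : Narrow (bbox A B)
      merged-narrow α spans = <⇒≱ r<d d≤r
        where
        r<d : r < d
        r<d = ≤-<-trans (≤-trans (spanning-merge-views α F↭ k∉F covers narrow spans)
                                 (viewα≤view α ((k , bbox A B) ∷ G) k (bbox A B)))
                        (head (head-wide D wide))

-- In fact r < d: if d ≤ r, the grid points of π form a covering narrow
-- initial family, which no d-wide decomposition can start from.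
proposition4 : (r : ℕ) (π : Perm) → GridPerm (2 * r + 4) (2 * r + 4) π →
    (d : ℕ) (D : Decomposition π) → WideDecomp d D → r ≤ d
proposition4 r π (_ , cols , rows , cols-chain , rows-chain , cells) d D wide with d ≤? r
... | no d≰r = <⇒≤ (≰⇒> d≰r)
... | yes d≤r = ⊥-elim (no-narrow-wide-decomposition d≤r D points-cover points-narrow wide)
  where
  open GridArgument π (2 * r + 4) cols rows cols-chain rows-chain cells
  open Bound r (+-monoʳ-≤ (2 * r) (n≤1+n 3))
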